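{- Let $n\ge1$, let $\tau\in S_n$ be the identity permutation and let $\sigma\in S_n$ with $\sigma\neq w_0$, where $w_0(i)=n+1-i$. Then the sequence $C_{(\sigma,\tau)}=((\sigma(1),\tau(1)),\dots,(\sigma(n),\tau(n)))$ is not the label sequence of a falling maximal chain of $\mathcal{P}_n$.
   Context: Identify a monotone lattice path from $(0,0)$ to $(n-k,k)$ with the $k$-subset of $[n]$ of positions of its North steps. For $k$-subsets $U=\{u_1<\dots<u_k\}$, $L=\{\ell_1<\dots<\ell_k\}$ of $[n]$ with $u_i\le\ell_i$ for all $i$, the lattice path matroid $M[U,L]$ is the matroid on $[n]$ whose bases are the $k$-sets $\{b_1<\dots<b_k\}$ with $u_i\le b_i\le\ell_i$. $\mathcal{P}_n$ is the poset of all lattice path matroids on $[n]$ ordered by the matroid quotient relation ($M'\le_q M$ iff there is a matroid $N$ on $[n]\sqcup T$ with $M=N\setminus T$, $M'=N/T$); covers have the form $M[U\setminus\{u\},L\setminus\{\ell\}]\lessdot M[U,L]$ and are labeled $(\ell,u)$. A maximal chain $M[\emptyset,\emptyset]=M_0\lessdot\cdots\lessdot M_n=M[[n],[n]]$ has label sequence $((\ell_1,u_1),\dots,(\ell_n,u_n))$ with $(\ell_i,u_i)=\lambda(M_{i-1}\lessdot M_i)$, and is falling if for each $1\le i<n$ it is not the case that both $\ell_i<\ell_{i+1}$ and $u_i<u_{i+1}$. -}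

module Defs where

open import Level using (Level; suc; zero)
open import Data.Nat as ℕ using (ℕ; _+_)
open import Data.Fin as Fin using (Fin; inject₁; opposite)
open import Data.Fin.Subset using (Subset; ⊥; ⊤; ⁅_⁆; _∈_; _∉_; _⊆_; _∪_; _─_)
open import Data.Fin.Permutation using (Permutation′; _⟨$⟩ʳ_)
open import Data.Vec using (Vec; []; _∷_; lookup; _++_)
open import Data.Product using (Σ; ∃; _×_; _,_)
open import Relation.Binary.PropositionalEquality using (_≡_)
open import Relation.Nullary using (¬_)

-- Convention: the ground set [n] = {1,…,n} is represented by Fin n,
-- element i ∈ [n] being the Fin index i-1 (order-preserving).

_⇔_ : ∀ {a b} → Set a → Set b → Set (a Level.⊔ b)
A ⇔ B = (A → B) × (B → A)

record Matroid (m : ℕ) : Set₁ where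
  field
    Basis    : Subset m → Set
    nonempty : ∃ λ B → Basis B
    exchange : ∀ {B₁ B₂ x} → Basis B₁ → Basis B₂ → x ∈ B₁ → x ∉ B₂ →
               ∃ λ y → y ∈ B₂ × y ∉ B₁ × Basis ((B₁ ─ ⁅ x ⁆) ∪ ⁅ y ⁆)
open Matroid public

Indep : ∀ {m} → Matroid m → Subset m → Set
Indep N I = ∃ λ B → Basis N B × I ⊆ B

-- A matroid N on [n] ⊔ T with T = {n+1,…,n+t}, i.e. on Fin (n + t);
-- a subset of Fin (n + t) is a pair S ++ R with S ⊆ [n], R ⊆ T.

DeletionBasis : ∀ {n t} → Matroid (n + t) → Subset n → Set
DeletionBasis {n} {t} N S =
  Indep N (S ++ ⊥) × (∀ S' → Indep N (S' ++ ⊥) → S ⊆ S' → S' ≡ S)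

RestrTBasis : ∀ {n t} → Matroid (n + t) → Subset t → Set
RestrTBasis {n} {t} N R =
  Indep N (⊥ {n} ++ R) × (∀ R' → Indep N (⊥ {n} ++ R') → R ⊆ R' → R' ≡ R)

ContractionBasis : ∀ {n t} → Matroid (n + t) → Subset n → Set
ContractionBasis {n} {t} N S = ∃ λ R → RestrTBasis {n} {t} N R × Basis N (S ++ R)

StrictlyIncreasing : ∀ {n k} → Vec (Fin n) k → Set
StrictlyIncreasing {k = k} v = ∀ (i j : Fin k) → i Fin.< j → lookup v i Fin.< lookup v j

elems : ∀ {n k} → Vec (Fin n) k → Subset n
elems []       = ⊥
elems (x ∷ xs) = ⁅ x ⁆ ∪ elems xs

record LPM (n : ℕ) : Set where
  field
    k      : ℕ
    U      : Vec (Fin n) k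
    L      : Vec (Fin n) k
    U-inc  : StrictlyIncreasing U
    L-inc  : StrictlyIncreasing L
    U≤L    : ∀ i → lookup U i Fin.≤ lookup L i
open LPM public

LPMBasis : ∀ {n} → LPM n → Subset n → Set
LPMBasis M B = ∃ λ (b : Vec (Fin _) (k M)) →
  StrictlyIncreasing b × elems b ≡ B ×
  (∀ i → lookup (U M) i Fin.≤ lookup b i × lookup b i Fin.≤ lookup (L M) i)

SameMatroid : ∀ {n} → LPM n → LPM n → Set
SameMatroid M M' = ∀ B → LPMBasis M B ⇔ LPMBasis M' B

_≤q_ : ∀ {n} → LPM n → LPM n → Set₁
_≤q_ {n} M' M = Σ ℕ λ t → Σ (Matroid (n + t)) λ N →
  (∀ S → LPMBasis M S ⇔ DeletionBasis {n} {t} N S) ×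
  (∀ S → LPMBasis M' S ⇔ ContractionBasis {n} {t} N S)

_<q_ : ∀ {n} → LPM n → LPM n → Set₁
M' <q M = M' ≤q M × ¬ SameMatroid M' M

_⋖_ : ∀ {n} → LPM n → LPM n → Set₁
_⋖_ {n} M' M = M' <q M × ¬ (Σ (LPM n) λ M'' → M' <q M'' × M'' <q M)

HasLabel : ∀ {n} → LPM n → LPM n → Fin n × Fin n → Set
HasLabel M' M (ℓ , u) =
  u ∈ elems (U M) × elems (U M') ≡ elems (U M) ─ ⁅ u ⁆ ×
  ℓ ∈ elems (L M) × elems (L M') ≡ elems (L M) ─ ⁅ ℓ ⁆

IsMaximalChain : ∀ {n} → (Fin (ℕ.suc n) → LPM n) → Set₁
IsMaximalChain {n} M =
  k (M Fin.zero) ≡ 0 ×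
  (elems (U (M (Fin.fromℕ n))) ≡ ⊤ × elems (L (M (Fin.fromℕ n))) ≡ ⊤) ×
  (∀ (i : Fin n) → M (inject₁ i) ⋖ M (Fin.suc i))

HasLabelSequence : ∀ {n} → (Fin (ℕ.suc n) → LPM n) → (Fin n → Fin n × Fin n) → Set
HasLabelSequence {n} M lab = ∀ (i : Fin n) → HasLabel (M (inject₁ i)) (M (Fin.suc i)) (lab i)

Falling : ∀ {n} → (Fin n → Fin n × Fin n) → Set
Falling {n} lab = ∀ (i j : Fin n) → Fin.toℕ j ≡ ℕ.suc (Fin.toℕ i) →
  ¬ (Data.Product.proj₁ (lab i) Fin.< Data.Product.proj₁ (lab j) ×
     Data.Product.proj₂ (lab i) Fin.< Data.Product.proj₂ (lab j))

C : ∀ {n} → Permutation′ n → Permutation′ n → Fin n → Fin n × Fin n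
C σ τ i = (σ ⟨$⟩ʳ i , τ ⟨$⟩ʳ i)

-- w₀(i) = n+1-i, i.e. opposite on 0-indexed Fin n
IsW₀ : ∀ {n} → Permutation′ n → Set
IsW₀ σ = ∀ i → σ ⟨$⟩ʳ i ≡ opposite i

{-# OPTIONS --safe #-}
-- Since τ is the identity, the second
-- coordinates of C_(σ,τ) increase at every step, so falling forces
-- σ(i) > σ(i+1) for all i.  A map [n] → [n] that drops at each of its n − 1
-- steps has to start at n and end at 1, descending by exactly one each time:
-- it is w₀.
module Submission where

open import Defs
open import Data.Nat as ℕ using (ℕ; suc; _≥_; _+_; _∸_)
open import Data.Nat.Properties
  using (+-identityʳ; +-suc; +-monoˡ-≤; +-monoʳ-<; n<1+n; <-trans; ≤-reflexive;
         m+n≤o⇒n≤o; m+n≤o⇒m≤o∸n; m+[n∸m]≡n; ≮⇒≥; ≤-antisym; ≤-trans; module ≤-Reasoning)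
open import Data.Fin as Fin using (Fin; zero; toℕ; fromℕ; fromℕ<; opposite)
open import Data.Fin.Properties
  using (toℕ-injective; toℕ-fromℕ; toℕ-fromℕ<; toℕ<n; opposite-prop; ≤∧≢⇒<; <⇒≢)
open import Data.Fin.Permutation using (Permutation′; _⟨$⟩ʳ_)
open import Data.Product using (Σ; _×_; _,_)
open import Function.Bundles using (Injection)
open import Function.Properties.Inverse using (↔⇒↣)
open import Relation.Binary.PropositionalEquality
  using (_≡_; _≢_; refl; sym; trans; cong; subst; subst₂)
open import Relation.Nullary using (¬_)

Descending : ∀ {n} → (Fin n → Fin n) → Set
Descending {n} f = ∀ (i j : Fin n) → toℕ j ≡ suc (toℕ i) → f j Fin.< f i

module _ {n} {f : Fin n → Fin n} (desc : Descending f) where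

  descending-drop : ∀ d (i j : Fin n) → toℕ j ≡ toℕ i + d → toℕ (f j) + d ℕ.≤ toℕ (f i)
  descending-drop ℕ.zero i j j≡i+0
    rewrite toℕ-injective {i = j} (trans j≡i+0 (+-identityʳ (toℕ i))) =
      ≤-reflexive (+-identityʳ (toℕ (f i)))
  descending-drop (suc d) i j j≡i+1+d = begin
    toℕ (f j) + suc d   ≡⟨ +-suc (toℕ (f j)) d ⟩
    suc (toℕ (f j)) + d ≤⟨ +-monoˡ-≤ d (desc l j l+1≡j) ⟩
    toℕ (f l) + d       ≤⟨ descending-drop d i l l≡i+d ⟩
    toℕ (f i)           ∎
    where
    open ≤-Reasoning
    i+d<n : toℕ i + d ℕ.< n
    i+d<n = <-trans (+-monoʳ-< (toℕ i) (n<1+n d)) (subst (ℕ._< n) j≡i+1+d (toℕ<n j))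
    l : Fin n
    l = fromℕ< i+d<n
    l≡i+d : toℕ l ≡ toℕ i + d
    l≡i+d = toℕ-fromℕ< i+d<n
    l+1≡j : toℕ j ≡ suc (toℕ l)
    l+1≡j = trans j≡i+1+d (trans (+-suc (toℕ i) d) (cong suc (sym l≡i+d)))

descending⇒opposite : ∀ {n} {f : Fin n → Fin n} → Descending f → ∀ i → f i ≡ opposite i
descending⇒opposite {suc m} {f} desc i =
  toℕ-injective (trans (≤-antisym upper lower) (sym (opposite-prop i)))
  where
  i≤m : toℕ i ℕ.≤ m
  i≤m = ℕ.s≤s⁻¹ (toℕ<n i)
  upper : toℕ (f i) ℕ.≤ m ∸ toℕ i
  upper = m+n≤o⇒m≤o∸n (toℕ (f i)) (≤-trans (descending-drop desc (toℕ i) zero i refl)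
                                              (ℕ.s≤s⁻¹ (toℕ<n (f zero))))
  lower : m ∸ toℕ i ℕ.≤ toℕ (f i)
  lower = m+n≤o⇒n≤o (toℕ (f (fromℕ m)))
            (descending-drop desc (m ∸ toℕ i) i (fromℕ m)
              (trans (toℕ-fromℕ m) (sym (m+[n∸m]≡n i≤m))))

falling-identity⇒descending : ∀ {n} (σ τ : Permutation′ n) → (∀ i → τ ⟨$⟩ʳ i ≡ i) →
                              Falling (C σ τ) → Descending (σ ⟨$⟩ʳ_)
falling-identity⇒descending σ τ τ-id falling i j j≡1+i =
  ≤∧≢⇒< (≮⇒≥ λ σi<σj → falling i j j≡1+i (σi<σj , τi<τj)) σj≢σi
  where
  i<j : i Fin.< j
  i<j = subst (toℕ i ℕ.<_) (sym j≡1+i) (n<1+n (toℕ i))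
  τi<τj : τ ⟨$⟩ʳ i Fin.< τ ⟨$⟩ʳ j
  τi<τj = subst₂ Fin._<_ (sym (τ-id i)) (sym (τ-id j)) i<j
  σj≢σi : σ ⟨$⟩ʳ j ≢ σ ⟨$⟩ʳ i
  σj≢σi σj≡σi = <⇒≢ i<j (sym (Injection.injective (↔⇒↣ σ) σj≡σi))

lemma3p15 : (n : ℕ) → n ≥ 1 → (σ τ : Permutation′ n) →
    (∀ i → τ ⟨$⟩ʳ i ≡ i) → ¬ IsW₀ σ →
    ¬ (Σ (Fin (suc n) → LPM n) λ M →
         IsMaximalChain M × HasLabelSequence M (C σ τ) × Falling (C σ τ))
lemma3p15 n _ σ τ τ-id σ≢w₀ (_ , _ , _ , falling) =
  σ≢w₀ (descending⇒opposite (falling-identity⇒descending σ τ τ-id falling))
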